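{- Let $0<\delta\le 1$. Let $G=(V,E)$ be a (multi)graph on a finite vertex set $V$ with $E=\bigcup_{i\in V}\mathcal M_i$, where each $\mathcal M_i$ is a partial matching on $V$ (edges of $\mathcal M_i$ are regarded as labeled by $i$, so parallel edges with distinct labels are allowed). Assume that all but at most $0.1\delta|V|$ of the matchings $\mathcal M_i$ have size at least $0.9\delta|V|$. Then there exists a subset $V'\subseteq V$ with $|V'|\ge\delta|V|$ such that the graph $G'=(V',E')$ with $E'=\bigcup_{i\in V'}\big(\mathcal M_i\cap(V'\times V')\big)$ has minimum degree at least $(\delta^2/4)\cdot|V|$.
   Context: Degrees are counted with multiplicity: a vertex's degree is the number of labeled edges incident to it.
   Formalization: The parameter δ is rational. -}

module Defs where

open import Data.Nat using (ℕ; zero; suc; _+_; _<ᵇ_)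
open import Data.Bool using (Bool; true; false; _∧_)
open import Data.Maybe using (Maybe; just; nothing)
open import Data.Fin using (Fin; toℕ) renaming (zero to fzero; suc to fsuc)
open import Data.Fin.Subset using (Subset)
open import Data.Vec using (lookup)
open import Data.Integer using (+_)
open import Data.Rational using (ℚ; _/_)
open import Relation.Binary.PropositionalEquality using (_≡_; _≢_)

countF : (n : ℕ) → (Fin n → Bool) → ℕ
countF zero p = 0
countF (suc n) p with p fzero
... | true  = suc (countF n (λ i → p (fsuc i)))
... | false = countF n (λ i → p (fsuc i))

ℕtoℚ : ℕ → ℚ
ℕtoℚ k = (+ k) / 1

-- A partial matching on the vertex set Fin n, given by the partner map:
-- partner u ≡ just v  iff  {u,v} is an edge of the matching (u ≠ v).
record Matching (n : ℕ) : Set where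
  field
    partner : Fin n → Maybe (Fin n)
    partner-sym : ∀ u v → partner u ≡ just v → partner v ≡ just u
    partner-irrefl : ∀ u → partner u ≢ just u
open Matching public

-- size (number of edges) of a matching: count edges {u,v} once, via u < v
edgeAt : ∀ {n} → Maybe (Fin n) → Fin n → Bool
edgeAt nothing  u = false
edgeAt (just v) u = toℕ u <ᵇ toℕ v

size : ∀ {n} → Matching n → ℕ
size {n} m = countF n (λ u → edgeAt (partner m u) u)

inS : ∀ {n} → Subset n → Fin n → Bool
inS S i = lookup S i

partnerIn : ∀ {n} → Subset n → Maybe (Fin n) → Bool
partnerIn S nothing  = false
partnerIn S (just v) = inS S v

-- degree of vertex u in G' = (V', E'), E' = ⋃_{i ∈ V'} (M i ∩ V'×V'),
-- counted with multiplicity of labels: each label i ∈ V' whose matching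
-- matches u to a vertex of V' contributes one edge at u.
degIn : ∀ {n} → (Fin n → Matching n) → Subset n → Fin n → ℕ
degIn {n} M S u = countF n (λ i → inS S i ∧ partnerIn S (partner (M i) u))

-- Peel the graph: starting from S = V, delete a vertex of degree below δ²n/4 in the
-- current subgraph for as long as there is one.  For i ∈ S let the loss of label i be the
-- number of vertices matched by Mᵢ that are not matched inside S by Mᵢ.  Deleting a vertex
-- of degree d raises the total loss by at most 2d < δ²n/2, so after c deletions the total
-- loss is at most c·δ²n/2 ≤ δ²n²/2.  Were peeling to push |S| just below δn, the at least
-- |S| − δn/10 labels of S with |Mᵢ| ≥ 0.9δn would each lose at least 1.8δn − |S| > 0.8δn
-- vertices, a total loss above δ²n²/2.  So peeling stops with |S| ≥ δn and all degrees
-- at least δ²n/4.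
module Submission where

open import Data.Bool using (Bool; true; false; _∧_; not)
open import Data.Fin using (Fin; toℕ; _≟_) renaming (zero to fzero; suc to fsuc)
open import Data.Fin.Properties using (any?)
open import Data.Fin.Subset using (Subset; inside; outside; _∈_; _∉_; ∣_∣; ⊤)
open import Data.Fin.Subset.Properties using (_∈?_; ∣⊤∣≡n)
open import Data.Integer using (-[1+_]; +≤+)
import Data.Integer as ℤ
open import Data.Integer.Properties using (pos-*; drop‿+≤+)
open import Data.Maybe using (Maybe; just; nothing; is-just; maybe)
open import Data.Maybe.Properties using (≡-dec)
open import Data.Nat using (ℕ; zero; suc; pred; _+_; _*_; _∸_; _≤_; _<_; _<ᵇ_; z≤n; s≤s; z<s; NonZero)
open import Data.Nat.Coprimality using (Coprime)
open import Data.Nat.Properties hiding (_≟_)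
open import Data.Nat.Tactic.RingSolver using (solve-∀)
open import Data.Product using (Σ; _×_; _,_)
open import Data.Rational using (ℚ; mkℚ; toℚᵘ; _/_; 0ℚ; 1ℚ)
import Data.Rational as ℚ
open import Data.Rational.Properties using (toℚᵘ-homo-*; toℚᵘ-mono-≤; toℚᵘ-cancel-≤; toℚᵘ-fromℚᵘ)
open import Data.Rational.Unnormalised using (mkℚᵘ; _≃_; *≤*) renaming (_≤_ to _≤ᵘ_)
open import Data.Rational.Unnormalised.Properties
  using (*-cong; ≃-trans; ≃-sym; ≃-reflexive; ≃-refl; ≤-respˡ-≃; ≤-respʳ-≃)
open import Data.Vec using (_∷_; []; _[_]≔_; here; there)
open import Data.Vec.Properties using (lookup∘update; lookup∘update′; lookup-replicate; []=⇒lookup)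
open import Defs
open import Function using (_∘_; _⇔_; mk⇔; Equivalence)
open import Relation.Binary.Definitions using (DecidableEquality)
open import Relation.Binary.PropositionalEquality
open import Relation.Nullary using (¬_; yes; no; contradiction)
open import Relation.Nullary.Decidable using (does; _×-dec_)

open import Algebra.Properties.Semiring.Sum +-*-semiring
  using (sum-syntax; sum-cong-≗; sum-replicate-zero; ∑-distrib-+; ∑-comm; *-distribˡ-sum)

𝟙 : Bool → ℕ
𝟙 true  = 1
𝟙 false = 0

𝟙-∧≤ˡ : ∀ a b → 𝟙 (a ∧ b) ≤ 𝟙 a
𝟙-∧≤ˡ true  true  = ≤-refl
𝟙-∧≤ˡ true  false = z≤n
𝟙-∧≤ˡ false b     = z≤n

𝟙-∧≤ʳ : ∀ a b → 𝟙 (a ∧ b) ≤ 𝟙 b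
𝟙-∧≤ʳ true  b = ≤-refl
𝟙-∧≤ʳ false b = z≤n

𝟙-<ᵇ-asym : ∀ a b → 𝟙 (a <ᵇ b) + 𝟙 (b <ᵇ a) ≤ 1
𝟙-<ᵇ-asym zero    zero    = z≤n
𝟙-<ᵇ-asym zero    (suc b) = s≤s z≤n
𝟙-<ᵇ-asym (suc a) zero    = s≤s z≤n
𝟙-<ᵇ-asym (suc a) (suc b) = 𝟙-<ᵇ-asym a b

∑-mono-≤ : ∀ {n} {f g : Fin n → ℕ} → (∀ i → f i ≤ g i) → ∑[ i < n ] f i ≤ ∑[ i < n ] g i
∑-mono-≤ {zero}  f≤g = z≤n
∑-mono-≤ {suc n} f≤g = +-mono-≤ (f≤g fzero) (∑-mono-≤ (f≤g ∘ fsuc))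

f≤∑f : ∀ {n} (f : Fin n → ℕ) i → f i ≤ ∑[ j < n ] f j
f≤∑f f fzero    = m≤m+n _ _
f≤∑f f (fsuc i) = ≤-trans (f≤∑f (f ∘ fsuc) i) (m≤n+m _ (f fzero))

∑-select : ∀ {n} (v : Fin n) (f : Fin n → ℕ) → ∑[ u < n ] (𝟙 (does (v ≟ u)) * f u) ≡ f v
∑-select {suc n} fzero    f =
  trans (cong₂ _+_ (+-identityʳ (f fzero)) (sum-replicate-zero n)) (+-identityʳ (f fzero))
∑-select {suc n} (fsuc v) f = ∑-select {n} v (f ∘ fsuc)

countF≡∑ : ∀ n (p : Fin n → Bool) → countF n p ≡ ∑[ i < n ] 𝟙 (p i)
countF≡∑ zero    p = refl
countF≡∑ (suc n) p with p fzero
... | true  = cong suc (countF≡∑ n (p ∘ fsuc))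
... | false = countF≡∑ n (p ∘ fsuc)

m∸n≤m∸o+p : ∀ m {n o p} → o ≤ n + p → m ∸ n ≤ m ∸ o + p
m∸n≤m∸o+p m {n} {o} {p} o≤n+p = m≤n+o⇒m∸n≤o m n (begin
  m                  ≤⟨ m≤n+m∸n m o ⟩
  o + (m ∸ o)        ≤⟨ +-monoˡ-≤ (m ∸ o) o≤n+p ⟩
  n + p + (m ∸ o)    ≡⟨ +-assoc n p (m ∸ o) ⟩
  n + (p + (m ∸ o))  ≡⟨ cong (n +_) (+-comm p (m ∸ o)) ⟩
  n + (m ∸ o + p)    ∎)
  where open ≤-Reasoning

-- x < y ≤ 2x means x = 1 + a + b and y = 2 + 2a + b.  Then 10z ≥ 10x − y = 8 + 8a + 9b and
-- 9y − 5x = 13 + 13a + 4b, and 2·(8 + 8a + 9b)·(13 + 13a + 4b) exceeds 50y² by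
-- 8 + 16a + 8a² + 98b + 98ab + 22b².
quadratic-gap : ∀ {x y z} → x < y → y ≤ 2 * x → 10 * x ≤ 10 * z + y →
                5 * (y * y) < 2 * z * (9 * y ∸ 5 * x)
quadratic-gap {x} {y} {z} x<y y≤2x 10x≤10z+y with m≤n⇒∃[o]m+o≡n x<y
... | a , refl with m≤n⇒∃[o]m+o≡n
                      (+-cancelˡ-≤ x (suc a) x (subst₂ _≤_ (sym (+-suc x a)) (cong (x +_) (+-identityʳ x)) y≤2x))
... | b , refl = *-cancelˡ-< 10 _ _ (begin-strict
  10 * (5 * (y * y))                          <⟨ m<m+n _ z<s ⟩
  10 * (5 * (y * y)) + suc (7 + 16 * a + 8 * a * a + 98 * b + 98 * a * b + 22 * b * b)
                                              ≡⟨ gap a b ⟩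
  2 * (8 + 8 * a + 9 * b) * w                 ≤⟨ *-monoˡ-≤ w (*-monoʳ-≤ 2 lower) ⟩
  2 * (10 * z) * w                            ≡⟨ regroup z w ⟩
  10 * (2 * z * w)                            ≡⟨ cong (λ t → 10 * (2 * z * t)) (sym 9y∸5x≡w) ⟩
  10 * (2 * z * (9 * y ∸ 5 * x))              ∎)
  where
  open ≤-Reasoning
  w : ℕ
  w = 13 + 13 * a + 4 * b

  9y∸5x≡w : 9 * y ∸ 5 * x ≡ w
  9y∸5x≡w = trans (cong (_∸ 5 * x) (split a b)) (m+n∸m≡n (5 * x) w)
    where
    split : ∀ a b → 9 * suc (suc a + b + a) ≡ 5 * (suc a + b) + (13 + 13 * a + 4 * b)
    split = solve-∀

  lower : 8 + 8 * a + 9 * b ≤ 10 * z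
  lower = +-cancelʳ-≤ y _ _ (subst (_≤ 10 * z + y) (split a b) 10x≤10z+y)
    where
    split : ∀ a b → 10 * (suc a + b) ≡ 8 + 8 * a + 9 * b + suc (suc a + b + a)
    split = solve-∀

  gap : ∀ a b → 10 * (5 * (suc (suc a + b + a) * suc (suc a + b + a)))
                  + suc (7 + 16 * a + 8 * a * a + 98 * b + 98 * a * b + 22 * b * b)
              ≡ 2 * (8 + 8 * a + 9 * b) * (13 + 13 * a + 4 * b)
  gap = solve-∀

  regroup : ∀ z w → 2 * (10 * z) * w ≡ 10 * (2 * z * w)
  regroup = solve-∀

infixl 6 _∖_
_∖_ : ∀ {n} → Subset n → Fin n → Subset n
S ∖ v = S [ v ]≔ outside

suc∣S∖v∣≡∣S∣ : ∀ {n} {S : Subset n} {v} → v ∈ S → suc ∣ S ∖ v ∣ ≡ ∣ S ∣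
suc∣S∖v∣≡∣S∣ {S = inside  ∷ S} here        = refl
suc∣S∖v∣≡∣S∣ {S = inside  ∷ S} (there v∈S) = cong suc (suc∣S∖v∣≡∣S∣ v∈S)
suc∣S∖v∣≡∣S∣ {S = outside ∷ S} (there v∈S) = suc∣S∖v∣≡∣S∣ v∈S

∣S∣≡∑ : ∀ {n} (S : Subset n) → ∣ S ∣ ≡ ∑[ i < n ] 𝟙 (inS S i)
∣S∣≡∑ []            = refl
∣S∣≡∑ (inside  ∷ S) = cong suc (∣S∣≡∑ S)
∣S∣≡∑ (outside ∷ S) = ∣S∣≡∑ S

𝟙-∖≤ : ∀ {n} (S : Subset n) v i → 𝟙 (inS (S ∖ v) i) ≤ 𝟙 (inS S i)
𝟙-∖≤ S v i with i ≟ v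
... | yes refl = ≤-trans (≤-reflexive (cong 𝟙 (lookup∘update i S outside))) z≤n
... | no  i≢v  = ≤-reflexive (cong 𝟙 (lookup∘update′ i≢v S outside))

lookup≡false⇒∉ : ∀ {n} {S : Subset n} {i} → inS S i ≡ false → i ∉ S
lookup≡false⇒∉ S-i≡false i∈S with () ← trans (sym ([]=⇒lookup i∈S)) S-i≡false

-- Matchings

module _ {n : ℕ} where

  infix 4 _≟ₘ_
  _≟ₘ_ : DecidableEquality (Maybe (Fin n))
  _≟ₘ_ = ≡-dec _≟_

  ∑-select-maybe : ∀ x (f : Fin n → ℕ) → ∑[ u < n ] (𝟙 (does (x ≟ₘ just u)) * f u) ≡ maybe f 0 x
  ∑-select-maybe (just v) f = ∑-select v f
  ∑-select-maybe nothing  f = sum-replicate-zero n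

  partner-≟-sym : ∀ (m : Matching n) u v →
                  does (partner m u ≟ₘ just v) ≡ does (partner m v ≟ₘ just u)
  partner-≟-sym m u v with partner m u ≟ₘ just v | partner m v ≟ₘ just u
  ... | yes _     | yes _     = refl
  ... | no  _     | no  _     = refl
  ... | yes u↦v  | no  v↦̸u  = contradiction (partner-sym m u v u↦v) v↦̸u
  ... | no  u↦̸v  | yes v↦u  = contradiction (partner-sym m v u v↦u) u↦̸v

  covered : Matching n → ℕ
  covered m = ∑[ u < n ] 𝟙 (is-just (partner m u))

  -- Double counting: the edge {u, w} is counted at u when u < w and at w when w < u.
  2*size≤covered : ∀ m → 2 * size m ≤ covered m
  2*size≤covered m = begin
    2 * size m                                     ≡⟨ cong (size m +_) (+-identityʳ (size m)) ⟩
    size m + size m                                ≡⟨ cong₂ _+_ size≡∑∑ size≡∑∑′ ⟩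
    ∑[ u < n ] ∑[ w < n ] (e u w * lt u w) + ∑[ u < n ] ∑[ w < n ] (e u w * lt w u)
      ≡⟨ sym (trans (sum-cong-≗ λ u → ∑-distrib-+ (λ w → e u w * lt u w) (λ w → e u w * lt w u))
                    (∑-distrib-+ (λ u → ∑[ w < n ] (e u w * lt u w)) (λ u → ∑[ w < n ] (e u w * lt w u)))) ⟩
    ∑[ u < n ] ∑[ w < n ] (e u w * lt u w + e u w * lt w u)
      ≤⟨ ∑-mono-≤ (λ u → ∑-mono-≤ λ w → both-orders u w) ⟩
    ∑[ u < n ] ∑[ w < n ] (e u w * 1)              ≡⟨ sum-cong-≗ (λ u → ∑-select-maybe (partner m u) (λ _ → 1)) ⟩
    ∑[ u < n ] maybe (λ _ → 1) 0 (partner m u)     ≡⟨ sum-cong-≗ (λ u → maybe-1≡𝟙-is-just (partner m u)) ⟩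
    covered m                                      ∎
    where
    open ≤-Reasoning
    e lt : Fin n → Fin n → ℕ
    e u w = 𝟙 (does (partner m u ≟ₘ just w))
    lt u w = 𝟙 (toℕ u <ᵇ toℕ w)

    𝟙-edgeAt : ∀ x u → 𝟙 (edgeAt x u) ≡ maybe (lt u) 0 x
    𝟙-edgeAt (just v) u = refl
    𝟙-edgeAt nothing  u = refl

    maybe-1≡𝟙-is-just : ∀ (x : Maybe (Fin n)) → maybe (λ _ → 1) 0 x ≡ 𝟙 (is-just x)
    maybe-1≡𝟙-is-just (just _) = refl
    maybe-1≡𝟙-is-just nothing  = refl

    size≡∑∑ : size m ≡ ∑[ u < n ] ∑[ w < n ] (e u w * lt u w)
    size≡∑∑ = trans (countF≡∑ n _) (sum-cong-≗ λ u →
      trans (𝟙-edgeAt (partner m u) u) (sym (∑-select-maybe (partner m u) (lt u))))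

    size≡∑∑′ : size m ≡ ∑[ u < n ] ∑[ w < n ] (e u w * lt w u)
    size≡∑∑′ = trans size≡∑∑ (trans (∑-comm (λ u w → e u w * lt u w))
      (sum-cong-≗ λ u → sum-cong-≗ λ w → cong (λ b → 𝟙 b * lt w u) (partner-≟-sym m w u)))

    both-orders : ∀ u w → e u w * lt u w + e u w * lt w u ≤ e u w * 1
    both-orders u w = begin
      e u w * lt u w + e u w * lt w u ≡⟨ sym (*-distribˡ-+ (e u w) (lt u w) (lt w u)) ⟩
      e u w * (lt u w + lt w u)       ≤⟨ *-monoʳ-≤ (e u w) (𝟙-<ᵇ-asym (toℕ u) (toℕ w)) ⟩
      e u w * 1                       ∎

-- Loss of a vertex set

module Loss {n : ℕ} (M : Fin n → Matching n) where

  kept : Subset n → Fin n → ℕ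
  kept S i = ∑[ u < n ] 𝟙 (inS S u ∧ partnerIn S (partner (M i) u))

  lost : Subset n → ℕ
  lost S = ∑[ i < n ] (𝟙 (inS S i) * (covered (M i) ∸ kept S i))

  kept≤∣S∣ : ∀ S i → kept S i ≤ ∣ S ∣
  kept≤∣S∣ S i = ≤-trans (∑-mono-≤ λ u → 𝟙-∧≤ˡ (inS S u) _) (≤-reflexive (sym (∣S∣≡∑ S)))

  lost-⊤ : lost ⊤ ≡ 0
  lost-⊤ = trans (sum-cong-≗ nothing-lost) (sum-replicate-zero n)
    where
    partnerIn-⊤ : ∀ x → partnerIn ⊤ x ≡ is-just x
    partnerIn-⊤ (just w) = lookup-replicate w true
    partnerIn-⊤ nothing  = refl

    kept-⊤ : ∀ i → kept ⊤ i ≡ covered (M i)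
    kept-⊤ i = sum-cong-≗ λ u →
      cong₂ (λ a b → 𝟙 (a ∧ b)) (lookup-replicate u true) (partnerIn-⊤ (partner (M i) u))

    nothing-lost : ∀ i → 𝟙 (inS ⊤ i) * (covered (M i) ∸ kept ⊤ i) ≡ 0
    nothing-lost i = begin
      𝟙 (inS ⊤ i) * (covered (M i) ∸ kept ⊤ i) ≡⟨ cong₂ (λ b k → 𝟙 b * (covered (M i) ∸ k))
                                                         (lookup-replicate i true) (kept-⊤ i) ⟩
      1 * (covered (M i) ∸ covered (M i))       ≡⟨ cong (_+ 0) (n∸n≡0 (covered (M i))) ⟩
      0                                         ∎
      where open ≡-Reasoning

  -- Removing v only destroys the pairs (u, partner u) with u = v or partner u = v.
  kept-∖ : ∀ S v i → kept S i ≤ kept (S ∖ v) i + 2 * 𝟙 (partnerIn S (partner (M i) v))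
  kept-∖ S v i = begin
    kept S i
      ≤⟨ ∑-mono-≤ (λ u → pair-∖ u (p u)) ⟩
    ∑[ u < n ] (𝟙 (inS (S ∖ v) u ∧ partnerIn (S ∖ v) (p u)) + at-v u + onto-v u)
      ≡⟨ trans (∑-distrib-+ _ onto-v) (cong (_+ ∑[ u < n ] onto-v u) (∑-distrib-+ _ at-v)) ⟩
    kept (S ∖ v) i + ∑[ u < n ] at-v u + ∑[ u < n ] onto-v u
      ≡⟨ cong₂ (λ a b → kept (S ∖ v) i + a + b) (∑-select v _) ∑-onto-v ⟩
    kept (S ∖ v) i + 𝟙 (partnerIn S (p v)) + 𝟙 (partnerIn S (p v))
      ≡⟨ +-assoc (kept (S ∖ v) i) _ _ ⟩
    kept (S ∖ v) i + (𝟙 (partnerIn S (p v)) + 𝟙 (partnerIn S (p v)))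
      ≡⟨ cong (λ t → kept (S ∖ v) i + (𝟙 (partnerIn S (p v)) + t)) (sym (+-identityʳ _)) ⟩
    kept (S ∖ v) i + 2 * 𝟙 (partnerIn S (p v)) ∎
    where
    open ≤-Reasoning
    p : Fin n → Maybe (Fin n)
    p = partner (M i)

    at-v onto-v : Fin n → ℕ
    at-v u   = 𝟙 (does (v ≟ u)) * 𝟙 (partnerIn S (p u))
    onto-v u = 𝟙 (does (p u ≟ₘ just v)) * 𝟙 (inS S u)

    ≤-left : ∀ {a b c d} → d ≤ a → d ≤ a + b + c
    ≤-left {a} {b} {c} d≤a = ≤-trans d≤a (≤-trans (m≤m+n a b) (m≤m+n (a + b) c))
    ≤-middle : ∀ {a b c d} → d ≤ b → d ≤ a + b + c
    ≤-middle {a} {b} {c} d≤b = ≤-trans d≤b (≤-trans (m≤n+m b a) (m≤m+n (a + b) c))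
    ≤-right : ∀ {a b c d} → d ≤ c → d ≤ a + b + c
    ≤-right {a} {b} {c} d≤c = ≤-trans d≤c (m≤n+m c (a + b))

    pair-∖ : ∀ u x → 𝟙 (inS S u ∧ partnerIn S x)
                   ≤ 𝟙 (inS (S ∖ v) u ∧ partnerIn (S ∖ v) x) + 𝟙 (does (v ≟ u)) * 𝟙 (partnerIn S x)
                     + 𝟙 (does (x ≟ₘ just v)) * 𝟙 (inS S u)
    pair-∖ u x with v ≟ u
    ... | yes refl =
      ≤-middle {a = 𝟙 (inS (S ∖ u) u ∧ partnerIn (S ∖ u) x)} {c = 𝟙 (does (x ≟ₘ just u)) * 𝟙 (inS S u)}
               (≤-trans (𝟙-∧≤ʳ (inS S u) _) (≤-reflexive (sym (+-identityʳ _))))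
    pair-∖ u nothing  | no v≢u = ≤-trans (𝟙-∧≤ʳ (inS S u) false) z≤n
    pair-∖ u (just w) | no v≢u with w ≟ v
    ... | yes refl =
      ≤-right {a = 𝟙 (inS (S ∖ w) u ∧ inS (S ∖ w) w)} {b = 0}
              (≤-trans (𝟙-∧≤ˡ (inS S u) _) (≤-reflexive (sym (+-identityʳ _))))
    ... | no  w≢v  =
      ≤-left (≤-reflexive (cong₂ (λ a b → 𝟙 (a ∧ b)) (sym (lookup∘update′ (v≢u ∘ sym) S outside))
                                                   (sym (lookup∘update′ w≢v S outside))))

    maybe-𝟙 : ∀ x → maybe (𝟙 ∘ inS S) 0 x ≡ 𝟙 (partnerIn S x)
    maybe-𝟙 (just w) = refl
    maybe-𝟙 nothing  = refl

    ∑-onto-v : ∑[ u < n ] onto-v u ≡ 𝟙 (partnerIn S (p v))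
    ∑-onto-v = trans (sum-cong-≗ λ u → cong (λ b → 𝟙 b * 𝟙 (inS S u)) (partner-≟-sym (M i) u v))
                     (trans (∑-select-maybe (p v) (𝟙 ∘ inS S)) (maybe-𝟙 (p v)))

  lost-∖ : ∀ S v → lost (S ∖ v) ≤ lost S + 2 * degIn M S v
  lost-∖ S v = begin
    lost (S ∖ v)
      ≤⟨ ∑-mono-≤ (λ i → *-mono-≤ (𝟙-∖≤ S v i) (m∸n≤m∸o+p (covered (M i)) {kept (S ∖ v) i} (kept-∖ S v i))) ⟩
    ∑[ i < n ] (𝟙 (inS S i) * (covered (M i) ∸ kept S i + 2 * e i))
      ≡⟨ sum-cong-≗ (λ i → *-distribˡ-+ (𝟙 (inS S i)) _ _) ⟩
    ∑[ i < n ] (𝟙 (inS S i) * (covered (M i) ∸ kept S i) + 𝟙 (inS S i) * (2 * e i))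
      ≡⟨ ∑-distrib-+ _ (λ i → 𝟙 (inS S i) * (2 * e i)) ⟩
    lost S + ∑[ i < n ] (𝟙 (inS S i) * (2 * e i))
      ≡⟨ cong (lost S +_) (sum-cong-≗ λ i → double (inS S i) _) ⟩
    lost S + ∑[ i < n ] (2 * edge i)
      ≡⟨ cong (lost S +_) (sym (trans (cong (2 *_) (countF≡∑ n _)) (*-distribˡ-sum 2 edge))) ⟩
    lost S + 2 * degIn M S v ∎
    where
    open ≤-Reasoning
    e edge : Fin n → ℕ
    e i = 𝟙 (partnerIn S (partner (M i) v))
    edge i = 𝟙 (inS S i ∧ partnerIn S (partner (M i) v))

    double : ∀ a b → 𝟙 a * (2 * 𝟙 b) ≡ 2 * 𝟙 (a ∧ b)
    double true  b = +-identityʳ (2 * 𝟙 b)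
    double false b = refl

-- Peeling

module Peeling {n : ℕ} (M : Fin n → Matching n) (p q : ℕ) .{{_ : NonZero q}} (B : Subset n)
               (B-small : 10 * q * ∣ B ∣ ≤ p * n)
               (M-large : ∀ i → i ∉ B → 9 * (p * n) ≤ 10 * q * size (M i)) where

  open Loss M

  -- With δ = p / q, the degree bound δ²n/4 ≤ deg reads T ≤ K · deg.
  K T : ℕ
  K = 4 * q * q
  T = p * p * n

  -- After deleting n − |S| vertices of degree < T / K, the loss is at most (n − |S|)·2T/K.
  LossBound : Subset n → Set
  LossBound S = K * lost S + 2 * ∣ S ∣ * T ≤ 2 * n * T

  lossBound-⊤ : LossBound ⊤
  lossBound-⊤ = ≤-reflexive (trans (cong₂ (λ l s → K * l + 2 * s * T) lost-⊤ (∣⊤∣≡n n))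
                                   (cong (_+ 2 * n * T) (*-zeroʳ K)))

  lossBound-∖ : ∀ {S v} → v ∈ S → K * degIn M S v < T → LossBound S → LossBound (S ∖ v)
  lossBound-∖ {S} {v} v∈S low bound = begin
    K * lost (S ∖ v) + 2 * ∣ S ∖ v ∣ * T
      ≤⟨ +-monoˡ-≤ (2 * ∣ S ∖ v ∣ * T) (*-monoʳ-≤ K (lost-∖ S v)) ⟩
    K * (lost S + 2 * degIn M S v) + 2 * ∣ S ∖ v ∣ * T
      ≡⟨ expand K (lost S) (degIn M S v) ∣ S ∖ v ∣ T ⟩
    K * lost S + 2 * (K * degIn M S v) + 2 * ∣ S ∖ v ∣ * T
      ≤⟨ +-monoˡ-≤ (2 * ∣ S ∖ v ∣ * T) (+-monoʳ-≤ (K * lost S) (*-monoʳ-≤ 2 (<⇒≤ low))) ⟩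
    K * lost S + 2 * T + 2 * ∣ S ∖ v ∣ * T
      ≡⟨ collect (K * lost S) ∣ S ∖ v ∣ T ⟩
    K * lost S + 2 * suc ∣ S ∖ v ∣ * T
      ≡⟨ cong (λ s → K * lost S + 2 * s * T) (suc∣S∖v∣≡∣S∣ v∈S) ⟩
    K * lost S + 2 * ∣ S ∣ * T
      ≤⟨ bound ⟩
    2 * n * T ∎
    where
    open ≤-Reasoning
    expand : ∀ k l d s t → k * (l + 2 * d) + 2 * s * t ≡ k * l + 2 * (k * d) + 2 * s * t
    expand = solve-∀
    collect : ∀ a s t → a + 2 * t + 2 * s * t ≡ a + 2 * suc s * t
    collect = solve-∀

  lossBound⇒lost≤ : ∀ S → LossBound S → K * lost S ≤ 2 * (p * n) * (p * n)
  lossBound⇒lost≤ S bound = ≤-trans (m≤m+n _ _) (≤-trans bound (≤-reflexive (square n p)))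
    where
    square : ∀ n p → 2 * n * (p * p * n) ≡ 2 * (p * n) * (p * n)
    square = solve-∀

  ∉B⇒covered : ∀ i → i ∉ B → 9 * (p * n) ≤ 5 * q * covered (M i)
  ∉B⇒covered i i∉B = begin
    9 * (p * n)              ≤⟨ M-large i i∉B ⟩
    10 * q * size (M i)      ≡⟨ halve q (size (M i)) ⟩
    5 * q * (2 * size (M i)) ≤⟨ *-monoʳ-≤ (5 * q) (2*size≤covered (M i)) ⟩
    5 * q * covered (M i)    ∎
    where
    open ≤-Reasoning
    halve : ∀ q s → 10 * q * s ≡ 5 * q * (2 * s)
    halve = solve-∀

  good : Subset n → ℕ
  good S = ∑[ i < n ] 𝟙 (inS S i ∧ not (inS B i))

  ∣S∣≤good+∣B∣ : ∀ S → ∣ S ∣ ≤ good S + ∣ B ∣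
  ∣S∣≤good+∣B∣ S = begin
    ∣ S ∣                                                  ≡⟨ ∣S∣≡∑ S ⟩
    ∑[ i < n ] 𝟙 (inS S i)                                 ≤⟨ ∑-mono-≤ (λ i → split (inS S i) (inS B i)) ⟩
    ∑[ i < n ] (𝟙 (inS S i ∧ not (inS B i)) + 𝟙 (inS B i)) ≡⟨ ∑-distrib-+ (λ i → 𝟙 (inS S i ∧ not (inS B i)))
                                                                          (λ i → 𝟙 (inS B i)) ⟩
    good S + ∑[ i < n ] 𝟙 (inS B i)                        ≡⟨ cong (good S +_) (sym (∣S∣≡∑ B)) ⟩
    good S + ∣ B ∣                                         ∎
    where
    open ≤-Reasoning
    split : ∀ a b → 𝟙 a ≤ 𝟙 (a ∧ not b) + 𝟙 b
    split true  true  = s≤s z≤n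
    split true  false = s≤s z≤n
    split false b     = z≤n

  good*gap≤lost : ∀ S → (9 * (p * n) ∸ 5 * (q * ∣ S ∣)) * good S ≤ 5 * q * lost S
  good*gap≤lost S = begin
    gap * good S                                  ≡⟨ *-distribˡ-sum gap is-good ⟩
    ∑[ i < n ] (gap * is-good i)                  ≤⟨ ∑-mono-≤ pointwise ⟩
    ∑[ i < n ] (5 * q * loss i)                   ≡⟨ sym (*-distribˡ-sum (5 * q) loss) ⟩
    5 * q * lost S                                ∎
    where
    open ≤-Reasoning
    gap : ℕ
    gap = 9 * (p * n) ∸ 5 * (q * ∣ S ∣)
    is-good loss : Fin n → ℕ
    is-good i = 𝟙 (inS S i ∧ not (inS B i))
    loss i = 𝟙 (inS S i) * (covered (M i) ∸ kept S i)

    pointwise : ∀ i → gap * is-good i ≤ 5 * q * loss i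
    pointwise i with inS S i | inS B i in B-i
    ... | true | false = begin
      gap * 1                                   ≡⟨ *-identityʳ gap ⟩
      gap                                       ≤⟨ ∸-mono (∉B⇒covered i (lookup≡false⇒∉ B-i))
                                                          (≤-trans (*-monoʳ-≤ (5 * q) (kept≤∣S∣ S i))
                                                                   (≤-reflexive (*-assoc 5 q _))) ⟩
      5 * q * covered (M i) ∸ 5 * q * kept S i  ≡⟨ sym (*-distribˡ-∸ (5 * q) (covered (M i)) (kept S i)) ⟩
      5 * q * (covered (M i) ∸ kept S i)        ≡⟨ cong (5 * q *_) (sym (+-identityʳ _)) ⟩
      5 * q * (1 * (covered (M i) ∸ kept S i))  ∎
    ... | true  | true = ≤-trans (≤-reflexive (*-zeroʳ gap)) z≤n
    ... | false | _    = ≤-trans (≤-reflexive (*-zeroʳ gap)) z≤n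

  ¬lossBound-singleton : ∀ S {v} → v ∈ S → ∣ S ∣ ≡ 1 → 0 < p * n → p * n ≤ q → ¬ LossBound S
  ¬lossBound-singleton S {v} v∈S ∣S∣≡1 pn>0 pn≤q bound = <-irrefl refl (begin-strict
    K                      ≡⟨ sym (*-identityʳ K) ⟩
    K * 1                  ≤⟨ *-monoʳ-≤ K 1≤lost ⟩
    K * lost S             ≤⟨ lossBound⇒lost≤ S bound ⟩
    2 * (p * n) * (p * n)  ≤⟨ *-mono-≤ (*-monoʳ-≤ 2 pn≤q) pn≤q ⟩
    2 * q * q              <⟨ *-monoˡ-< q (*-monoˡ-< q (m<m+n 2 {2} z<s)) ⟩
    K                      ∎)
    where
    open ≤-Reasoning
    v∉B : v ∉ B
    v∉B v∈B = <⇒≱ (*-monoˡ-< q (m<m+n 1 {9} z<s)) (begin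
      10 * q             ≡⟨ sym (*-identityʳ (10 * q)) ⟩
      10 * q * 1         ≤⟨ *-monoʳ-≤ (10 * q) (≤-trans (s≤s z≤n) (≤-reflexive (suc∣S∖v∣≡∣S∣ v∈B))) ⟩
      10 * q * ∣ B ∣     ≤⟨ B-small ⟩
      p * n              ≤⟨ pn≤q ⟩
      q                  ≡⟨ sym (*-identityˡ q) ⟩
      1 * q              ∎)

    size>0 : 0 < size (M v)
    size>0 = n≢0⇒n>0 λ size≡0 → <⇒≱ pn>0 (begin
      p * n                  ≤⟨ m≤m+n (p * n) (8 * (p * n)) ⟩
      9 * (p * n)            ≤⟨ M-large v v∉B ⟩
      10 * q * size (M v)    ≡⟨ cong (10 * q *_) size≡0 ⟩
      10 * q * 0             ≡⟨ *-zeroʳ (10 * q) ⟩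
      0                      ∎)

    1≤lost : 1 ≤ lost S
    1≤lost = begin
      1                                         ≤⟨ ∸-mono {2} {covered (M v)} {1}
                                                     (≤-trans (*-monoʳ-≤ 2 size>0) (2*size≤covered (M v)))
                                                     (≤-trans (kept≤∣S∣ S v) (≤-reflexive ∣S∣≡1)) ⟩
      covered (M v) ∸ kept S v                  ≡⟨ sym (+-identityʳ _) ⟩
      1 * (covered (M v) ∸ kept S v)            ≡⟨ cong (λ b → 𝟙 b * (covered (M v) ∸ kept S v))
                                                        (sym ([]=⇒lookup v∈S)) ⟩
      𝟙 (inS S v) * (covered (M v) ∸ kept S v)  ≤⟨ f≤∑f (λ i → 𝟙 (inS S i) * (covered (M i) ∸ kept S i)) v ⟩
      lost S                                    ∎

  ¬lossBound-small : ∀ S {k} → ∣ S ∣ ≡ suc k → q * suc k < p * n → p * n ≤ q * suc (suc k) →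
                     ¬ LossBound S
  ¬lossBound-small S {k} ∣S∣≡1+k below above bound =
    <⇒≱ (quadratic-gap {z = z} below y≤2x 10x≤10z+y) 2zw≤5y²
    where
    open ≤-Reasoning
    x y z w : ℕ
    x = q * suc k
    y = p * n
    z = q * good S
    w = 9 * y ∸ 5 * x

    y≤2x : y ≤ 2 * x
    y≤2x = begin
      y                    ≤⟨ above ⟩
      q * suc (suc k)      ≤⟨ *-monoʳ-≤ q (s≤s (m≤n+m (suc k) k)) ⟩
      q * (suc k + suc k)  ≡⟨ *-distribˡ-+ q (suc k) (suc k) ⟩
      x + x                ≡⟨ cong (x +_) (sym (+-identityʳ x)) ⟩
      2 * x                ∎

    10x≤10z+y : 10 * x ≤ 10 * z + y
    10x≤10z+y = begin
      10 * (q * suc k)             ≤⟨ *-monoʳ-≤ 10 (*-monoʳ-≤ q (≤-trans (≤-reflexive (sym ∣S∣≡1+k))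
                                                                       (∣S∣≤good+∣B∣ S))) ⟩
      10 * (q * (good S + ∣ B ∣))  ≡⟨ distribute q (good S) ∣ B ∣ ⟩
      10 * z + 10 * q * ∣ B ∣      ≤⟨ +-monoʳ-≤ (10 * z) B-small ⟩
      10 * z + y                   ∎
      where
      distribute : ∀ q g b → 10 * (q * (g + b)) ≡ 10 * (q * g) + 10 * q * b
      distribute = solve-∀

    2zw≤5y² : 2 * z * w ≤ 5 * (y * y)
    2zw≤5y² = *-cancelˡ-≤ (2 * q) {{m*n≢0 2 q}} (begin
      2 * q * (2 * z * w)      ≡⟨ regroup q (good S) w ⟩
      K * (w * good S)         ≤⟨ *-monoʳ-≤ K (subst (λ s → (9 * y ∸ 5 * (q * s)) * good S ≤ 5 * q * lost S)
                                                     ∣S∣≡1+k (good*gap≤lost S)) ⟩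
      K * (5 * q * lost S)     ≡⟨ swap K (5 * q) (lost S) ⟩
      5 * q * (K * lost S)     ≤⟨ *-monoʳ-≤ (5 * q) (lossBound⇒lost≤ S bound) ⟩
      5 * q * (2 * y * y)      ≡⟨ rescale q y ⟩
      2 * q * (5 * (y * y))    ∎)
      where
      regroup : ∀ q g w → 2 * q * (2 * (q * g) * w) ≡ 4 * q * q * (w * g)
      regroup = solve-∀
      swap : ∀ a b c → a * (b * c) ≡ b * (a * c)
      swap = solve-∀
      rescale : ∀ q y → 5 * q * (2 * y * y) ≡ 2 * q * (5 * (y * y))
      rescale = solve-∀

  record Core : Set where
    constructor core
    field
      vertices   : Subset n
      large      : p * n ≤ q * ∣ vertices ∣
      min-degree : ∀ u → u ∈ vertices → T ≤ K * degIn M vertices u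

  -- When a deletion would leave fewer than δn vertices, the loss bound is contradicted by
  -- the set after the deletion, or by the set before it when that is a single vertex.
  peel : ∀ s S → ∣ S ∣ ≡ s → p * n ≤ q * s → LossBound S → Core
  peel s S ∣S∣≡s large-S bound with any? (λ v → v ∈? S ×-dec K * degIn M S v <? T)
  ... | no no-low = core S (subst (λ t → p * n ≤ q * t) (sym ∣S∣≡s) large-S)
                         (λ u u∈S → ≮⇒≥ λ low → no-low (u , u∈S , low))
  peel zero S ∣S∣≡0 _ _ | yes (v , v∈S , _) = contradiction (trans (suc∣S∖v∣≡∣S∣ v∈S) ∣S∣≡0) λ ()
  peel (suc k) S ∣S∣≡1+k large-S bound | yes (v , v∈S , low) with p * n ≤? q * k
  ... | yes large-S∖v = peel k (S ∖ v) ∣S∖v∣≡k large-S∖v (lossBound-∖ v∈S low bound)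
    where
    ∣S∖v∣≡k : ∣ S ∖ v ∣ ≡ k
    ∣S∖v∣≡k = suc-injective (trans (suc∣S∖v∣≡∣S∣ v∈S) ∣S∣≡1+k)
  peel (suc zero) S ∣S∣≡1 large-S bound | yes (v , v∈S , low) | no small =
    contradiction bound (¬lossBound-singleton S v∈S ∣S∣≡1 (subst (_< p * n) (*-zeroʳ q) (≰⇒> small))
                                                          (≤-trans large-S (≤-reflexive (*-identityʳ q))))
  peel (suc (suc k)) S ∣S∣≡2+k large-S bound | yes (v , v∈S , low) | no small =
    contradiction (lossBound-∖ v∈S low bound)
                  (¬lossBound-small (S ∖ v) (suc-injective (trans (suc∣S∖v∣≡∣S∣ v∈S) ∣S∣≡2+k)) (≰⇒> small) large-S)

  peel-⊤ : p ≤ q → Core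
  peel-⊤ p≤q = peel n ⊤ (∣⊤∣≡n n) (*-monoˡ-≤ n p≤q) lossBound-⊤

-- Clearing denominators

-- x ≐ a /1+ b says that x equals a / (1 + b); it is a record so that x can be inferred.
infix 4 _≐_/1+_
record _≐_/1+_ (x : ℚ) (a b : ℕ) : Set where
  constructor fraction
  field toℚᵘ≃ : toℚᵘ x ≃ mkℚᵘ (ℤ.+ a) b

ℕtoℚ-≐ : ∀ k → ℕtoℚ k ≐ k /1+ 0
ℕtoℚ-≐ k = fraction (toℚᵘ-fromℚᵘ (mkℚᵘ (ℤ.+ k) 0))

*-≐ : ∀ {x y a b c d} → x ≐ a /1+ b → y ≐ c /1+ d → x ℚ.* y ≐ a * c /1+ pred (suc b * suc d)
*-≐ {x} {y} {a} {b} {c} {d} (fraction x≃) (fraction y≃) = fraction (≃-trans (toℚᵘ-homo-* x y)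
  (≃-trans (*-cong x≃ y≃) (≃-reflexive (cong (λ z → mkℚᵘ z (pred (suc b * suc d))) (sym (pos-* a c))))))

≤-≐ : ∀ {x y a b c d} → x ≐ a /1+ b → y ≐ c /1+ d → x ℚ.≤ y ⇔ a * suc d ≤ c * suc b
≤-≐ {x} {y} {a} {b} {c} {d} (fraction x≃) (fraction y≃) = mk⇔
  (λ x≤y → unfold (≤-respʳ-≃ y≃ (≤-respˡ-≃ x≃ (toℚᵘ-mono-≤ x≤y))))
  (λ ad≤cb → toℚᵘ-cancel-≤ (≤-respʳ-≃ (≃-sym y≃) (≤-respˡ-≃ (≃-sym x≃) (fold ad≤cb))))
  where
  unfold : mkℚᵘ (ℤ.+ a) b ≤ᵘ mkℚᵘ (ℤ.+ c) d → a * suc d ≤ c * suc b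
  unfold (*≤* le) = drop‿+≤+ (subst₂ ℤ._≤_ (sym (pos-* a (suc d))) (sym (pos-* c (suc b))) le)
  fold : a * suc d ≤ c * suc b → mkℚᵘ (ℤ.+ a) b ≤ᵘ mkℚᵘ (ℤ.+ c) d
  fold le = *≤* (subst₂ ℤ._≤_ (pos-* a (suc d)) (pos-* c (suc b)) (+≤+ le))

module Scaling (p d n : ℕ) .(c : Coprime p (suc d)) where

  δ : ℚ
  δ = mkℚ (ℤ.+ p) d c

  q : ℕ
  q = suc d

  δ≐ : δ ≐ p /1+ d
  δ≐ = fraction ≃-refl

  1ℚ≐ : 1ℚ ≐ 1 /1+ 0
  1ℚ≐ = fraction ≃-refl

  1/10≐ : (ℤ.+ 1) / 10 ≐ 1 /1+ 9
  1/10≐ = fraction ≃-refl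

  9/10≐ : (ℤ.+ 9) / 10 ≐ 9 /1+ 9
  9/10≐ = fraction ≃-refl

  1/4≐ : (ℤ.+ 1) / 4 ≐ 1 /1+ 3
  1/4≐ = fraction ≃-refl

  δ≤1⇒p≤q : δ ℚ.≤ 1ℚ → p ≤ q
  δ≤1⇒p≤q δ≤1 = subst₂ _≤_ (*-identityʳ p) (*-identityˡ q) (Equivalence.to (≤-≐ δ≐ 1ℚ≐) δ≤1)

  b≤δn/10⇒10qb≤pn : ∀ b → ℕtoℚ b ℚ.≤ (ℤ.+ 1) / 10 ℚ.* δ ℚ.* ℕtoℚ n → 10 * q * b ≤ p * n
  b≤δn/10⇒10qb≤pn b b≤ = subst₂ _≤_ (eq₁ b d) (eq₂ p n)
    (Equivalence.to (≤-≐ (ℕtoℚ-≐ b) (*-≐ (*-≐ 1/10≐ δ≐) (ℕtoℚ-≐ n))) b≤)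
    where
    eq₁ : ∀ b d → b * (10 * suc d * 1) ≡ 10 * suc d * b
    eq₁ = solve-∀
    eq₂ : ∀ p n → 1 * p * n * 1 ≡ p * n
    eq₂ = solve-∀

  9δn/10≤s⇒9pn≤10qs : ∀ s → (ℤ.+ 9) / 10 ℚ.* δ ℚ.* ℕtoℚ n ℚ.≤ ℕtoℚ s → 9 * (p * n) ≤ 10 * q * s
  9δn/10≤s⇒9pn≤10qs s ≤s = subst₂ _≤_ (eq₁ p n) (eq₂ s d)
    (Equivalence.to (≤-≐ (*-≐ (*-≐ 9/10≐ δ≐) (ℕtoℚ-≐ n)) (ℕtoℚ-≐ s)) ≤s)
    where
    eq₁ : ∀ p n → 9 * p * n * 1 ≡ 9 * (p * n)
    eq₁ = solve-∀
    eq₂ : ∀ s d → s * (10 * suc d * 1) ≡ 10 * suc d * s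
    eq₂ = solve-∀

  pn≤qk⇒δn≤k : ∀ k → p * n ≤ q * k → δ ℚ.* ℕtoℚ n ℚ.≤ ℕtoℚ k
  pn≤qk⇒δn≤k k pn≤qk = Equivalence.from (≤-≐ (*-≐ δ≐ (ℕtoℚ-≐ n)) (ℕtoℚ-≐ k))
    (subst₂ _≤_ (eq₁ p n) (eq₂ k d) pn≤qk)
    where
    eq₁ : ∀ p n → p * n ≡ p * n * 1
    eq₁ = solve-∀
    eq₂ : ∀ k d → suc d * k ≡ k * (suc d * 1)
    eq₂ = solve-∀

  ppn≤4qqk⇒δδn/4≤k : ∀ k → p * p * n ≤ 4 * q * q * k →
                     δ ℚ.* δ ℚ.* ((ℤ.+ 1) / 4) ℚ.* ℕtoℚ n ℚ.≤ ℕtoℚ k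
  ppn≤4qqk⇒δδn/4≤k k ppn≤4qqk = Equivalence.from (≤-≐ (*-≐ (*-≐ (*-≐ δ≐ δ≐) 1/4≐) (ℕtoℚ-≐ n)) (ℕtoℚ-≐ k))
    (subst₂ _≤_ (eq₁ p n) (eq₂ k d) ppn≤4qqk)
    where
    eq₁ : ∀ p n → p * p * n ≡ p * p * 1 * n * 1
    eq₁ = solve-∀
    eq₂ : ∀ k d → 4 * suc d * suc d * k ≡ k * (suc d * suc d * 4 * 1)
    eq₂ = solve-∀

lemma3p7 : (δ : ℚ) → 0ℚ ℚ.< δ → δ ℚ.≤ 1ℚ →
    (n : ℕ) → (M : Fin n → Matching n) →
    Σ (Subset n) (λ B → (ℕtoℚ ∣ B ∣ ℚ.≤ ((ℤ.+ 1) / 10) ℚ.* δ ℚ.* ℕtoℚ n)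
      × (∀ i → i ∉ B → ((ℤ.+ 9) / 10) ℚ.* δ ℚ.* ℕtoℚ n ℚ.≤ ℕtoℚ (size (M i)))) →
    Σ (Subset n) (λ V' → (δ ℚ.* ℕtoℚ n ℚ.≤ ℕtoℚ ∣ V' ∣)
      × (∀ u → u ∈ V' → (δ ℚ.* δ ℚ.* ((ℤ.+ 1) / 4)) ℚ.* ℕtoℚ n ℚ.≤ ℕtoℚ (degIn M V' u)))
lemma3p7 (mkℚ -[1+ _ ] _ _) (ℚ.*<* ()) _ _ _ _
lemma3p7 (mkℚ (ℤ.+ p) d c) _ δ≤1 n M (B , B-small , M-large) =
  vertices , pn≤qk⇒δn≤k ∣ vertices ∣ large ,
  λ u u∈V′ → ppn≤4qqk⇒δδn/4≤k (degIn M vertices u) (min-degree u u∈V′)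
  where
  open Scaling p d n c
  open Peeling M p q B (b≤δn/10⇒10qb≤pn ∣ B ∣ B-small)
                       (λ i i∉B → 9δn/10≤s⇒9pn≤10qs (size (M i)) (M-large i i∉B))
  open Core (peel-⊤ (δ≤1⇒p≤q δ≤1))
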